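{- Let $k$ be a positive integer. Let $G=(V,E,\partial)$ be a finite undirected graph whose vertex set is $V=\{v_1,v_2,v_3,v_4\}$ (four distinct vertices), such that the degree of each of $v_1,v_2,v_3,v_4$ is at least $k$. Then there exist $k$ elements $p_1,\ldots,p_k\in A(E)$, no two of which have a common nontrivial summand, such that $\partial(p_1)=\cdots=\partial(p_k)=v_1+v_2+v_3+v_4$.
   Context: A graph $G=(V,E,\partial)$ consists of a finite nonempty vertex set $V$, a finite edge set $E$, and a map $\partial$ assigning to each edge a set of exactly two distinct vertices (parallel edges allowed, no loops). The degree of a vertex $v$ is the number of edges $e$ with $v\in\partial(e)$. $A(S)$ is the $\mathbb{F}_2$-vector space of formal $\mathbb{F}_2$-linear combinations of elements of $S$; elements of $A(E)$ are called chains of edges, and the summands of a chain are the edges occurring with coefficient $1$. Two chains have no common nontrivial summand if no edge is a summand of both. $\partial$ extends $\mathbb{F}_2$-linearly to $A(E)\to A(V)$, sending an edge to the sum of its two endpoints. -}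

module Defs where

open import Data.Nat using (ℕ; zero; suc)
open import Data.Fin using (Fin; zero; suc; _≟_)
open import Data.Bool using (Bool; true; false; _xor_; _∧_)
open import Data.Product using (_×_; _,_; proj₁; proj₂)
open import Relation.Nullary using (¬_; does)
open import Relation.Binary.PropositionalEquality using (_≡_)

-- A graph with vertex set Fin n and edge set Fin m (parallel edges allowed).
record Graph (n m : ℕ) : Set where
  field
    ends     : Fin m → Fin n × Fin n
    noLoops  : ∀ e → ¬ (proj₁ (ends e) ≡ proj₂ (ends e))
open Graph public

incident : ∀ {n m} → Graph n m → Fin m → Fin n → Bool
incident G e v with ends G e
... | (a , b) = does (v ≟ a) Data.Bool.∨ does (v ≟ b)

countB : ∀ {m} → (Fin m → Bool) → ℕ
countB {zero}  f = zero
countB {suc m} f with f zero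
... | true  = suc (countB (λ i → f (suc i)))
... | false = countB (λ i → f (suc i))

degree : ∀ {n m} → Graph n m → Fin n → ℕ
degree G v = countB (λ e → incident G e v)

-- 𝔽₂-linear combinations: A(S) for S = Fin k, as coefficient functions
A : ℕ → Set
A k = Fin k → Bool

xorSum : ∀ {m} → (Fin m → Bool) → Bool
xorSum {zero}  f = false
xorSum {suc m} f = f zero xor xorSum (λ i → f (suc i))

boundary : ∀ {n m} → Graph n m → A m → A n
boundary G p v = xorSum (λ e → p e ∧ incident G e v)

allVertices : ∀ {n} → A n
allVertices _ = true

NoCommonSummand : ∀ {m} → A m → A m → Set
NoCommonSummand p q = ∀ e → ¬ (p e ≡ true × q e ≡ true)

module Submission where

-- Greedy removal. If every vertex has degree at least k + 1 in a set S of edges, S contains a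
-- chain J with ∂J = v₁ + v₂ + v₃ + v₄ whose removal leaves every degree at least k. If S
-- contains a perfect matching, take it: each degree drops by one. Otherwise, as no vertex is
-- isolated, the edges of S form a star K₁,₃ with multiple edges: every edge meets the centre,
-- so the centre has degree at least 3(k + 1) and can afford to lose the three edges of J.

open import Defs
open import Algebra.Bundles using (CommutativeRing; CommutativeMonoid)
import Algebra.Properties.CommutativeSemigroup as CommutativeSemigroupProperties
open import Data.Nat using (ℕ; zero; suc; _+_; _≤_; _<_; z≤n; s≤s)
import Data.Nat.Properties as ℕ
open import Data.Fin using (Fin; zero; suc; _≟_; #_)
open import Data.Fin.Properties using (any?)
open import Data.Fin.Permutation using (Permutation′; _⟨$⟩ʳ_; _⟨$⟩ˡ_; inverseˡ; inverseʳ; id; transpose)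
open import Data.Bool using (Bool; true; false; _xor_; _∧_; _∨_; not)
open import Data.Bool.Properties
  using (xor-identityʳ; xor-∧-commutativeRing; ∧-distribʳ-xor; ∨-comm; ∨-zeroʳ; ∧-conicalˡ; ∧-conicalʳ; ¬-not)
  renaming (_≟_ to _≟ᵇ_)
open import Data.Product using (Σ; ∃; _×_; _,_; proj₁; proj₂)
open import Data.Sum using (_⊎_; inj₁; inj₂)
open import Data.Empty using (⊥; ⊥-elim)
open import Data.Vec.Functional using (_∷_)
open import Function using (_∘_; mk⇔)
open import Relation.Nullary using (¬_; Dec; does; yes; no; map′; _×-dec_)
open import Relation.Nullary.Decidable using (dec-true; does-⇔)
open import Relation.Binary.PropositionalEquality
  using (_≡_; _≢_; refl; sym; trans; cong; cong₂; subst; module ≡-Reasoning)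

private
  module +-Semigroup = CommutativeSemigroupProperties ℕ.+-commutativeSemigroup
  module xor-Semigroup = CommutativeSemigroupProperties
    (CommutativeMonoid.commutativeSemigroup (CommutativeRing.+-commutativeMonoid xor-∧-commutativeRing))

toℕ : Bool → ℕ
toℕ false = 0
toℕ true  = 1

_⊆_ : ∀ {m} → A m → A m → Set
p ⊆ q = ∀ e → p e ≡ true → q e ≡ true

_∪_ _∩_ _⊕_ _∖_ : ∀ {m} → A m → A m → A m
(p ∪ q) e = p e ∨ q e
(p ∩ q) e = p e ∧ q e
(p ⊕ q) e = p e xor q e
(p ∖ q) e = p e ∧ not (q e)

edge : ∀ {m} → Fin m → A m
edge a e = does (a ≟ e)

∪-⊆ : ∀ {m} {p q r : A m} → p ⊆ r → q ⊆ r → (p ∪ q) ⊆ r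
∪-⊆ {p = p} p⊆r q⊆r e p∪q with p e in pe
... | true  = p⊆r e pe
... | false = q⊆r e p∪q

⊕-⊆-∪ : ∀ {m} (p q : A m) → (p ⊕ q) ⊆ (p ∪ q)
⊕-⊆-∪ p q e with p e
... | true  = λ _ → refl
... | false = λ q≡true → q≡true

⊕-⊆ : ∀ {m} {p q r : A m} → p ⊆ r → q ⊆ r → (p ⊕ q) ⊆ r
⊕-⊆ {p = p} {q} p⊆r q⊆r e = ∪-⊆ p⊆r q⊆r e ∘ ⊕-⊆-∪ p q e

∩-monoʳ : ∀ {m} {S p q : A m} → (∀ e → S e ≡ true → p e ≡ true → q e ≡ true) → (S ∩ p) ⊆ (S ∩ q)
∩-monoʳ {S = S} {p} S∩p⇒q e with S e in Se | p e in pe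
... | true  | true  = λ _ → S∩p⇒q e Se pe
... | true  | false = λ ()
... | false | _     = λ ()

edge-⊆ : ∀ {m} {S : A m} {a} → S a ≡ true → edge a ⊆ S
edge-⊆ {a = a} Sa e a≟e with a ≟ e
... | yes refl = Sa

disjoint-∪ : ∀ {m} {p q r : A m} → NoCommonSummand p q → NoCommonSummand p r → NoCommonSummand p (q ∪ r)
disjoint-∪ {q = q} p∩q p∩r e (pe , q∪r) with q e in qe
... | true  = p∩q e (pe , qe)
... | false = p∩r e (pe , q∪r)

countB-suc : ∀ {m} (f : A (suc m)) → countB f ≡ toℕ (f zero) + countB (f ∘ suc)
countB-suc f with f zero
... | true  = refl
... | false = refl

countB-false : ∀ {m} (f : A m) → (∀ e → f e ≡ false) → countB f ≡ 0
countB-false {zero}  f _ = refl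
countB-false {suc m} f f≡false rewrite countB-suc f | f≡false zero =
  countB-false (f ∘ suc) (f≡false ∘ suc)

countB-positive : ∀ {m} (f : A m) → 0 < countB f → ∃ λ e → f e ≡ true
countB-positive f 0<count with any? (λ e → f e ≟ᵇ true)
... | yes witness = witness
... | no  none    with () ← subst (0 <_) (countB-false f (λ e → ¬-not (λ fe → none (e , fe)))) 0<count

countB-mono : ∀ {m} {f g : A m} → f ⊆ g → countB f ≤ countB g
countB-mono {zero}          _   = z≤n
countB-mono {suc m} {f} {g} f⊆g rewrite countB-suc f | countB-suc g =
  ℕ.+-mono-≤ (toℕ-mono (f⊆g zero)) (countB-mono (f⊆g ∘ suc))
  where
  toℕ-mono : ∀ {a b} → (a ≡ true → b ≡ true) → toℕ a ≤ toℕ b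
  toℕ-mono {false} _   = z≤n
  toℕ-mono {true}  a⇒b rewrite a⇒b refl = ℕ.≤-refl

countB-∪-∩ : ∀ {m} (f g : A m) → countB (f ∪ g) + countB (f ∩ g) ≡ countB f + countB g
countB-∪-∩ {zero}  f g = refl
countB-∪-∩ {suc m} f g = begin
  countB (f ∪ g) + countB (f ∩ g)
    ≡⟨ cong₂ _+_ (countB-suc (f ∪ g)) (countB-suc (f ∩ g)) ⟩
  (toℕ (a ∨ b) + countB (f′ ∪ g′)) + (toℕ (a ∧ b) + countB (f′ ∩ g′))
    ≡⟨ +-Semigroup.interchange (toℕ (a ∨ b)) _ (toℕ (a ∧ b)) _ ⟩
  (toℕ (a ∨ b) + toℕ (a ∧ b)) + (countB (f′ ∪ g′) + countB (f′ ∩ g′))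
    ≡⟨ cong₂ _+_ (toℕ-∨-∧ a b) (countB-∪-∩ f′ g′) ⟩
  (toℕ a + toℕ b) + (countB f′ + countB g′)
    ≡⟨ +-Semigroup.interchange (toℕ a) (toℕ b) _ _ ⟩
  (toℕ a + countB f′) + (toℕ b + countB g′)
    ≡⟨ cong₂ _+_ (countB-suc f) (countB-suc g) ⟨
  countB f + countB g ∎
  where
  open ≡-Reasoning
  a b : Bool
  a = f zero
  b = g zero
  f′ g′ : A m
  f′ = f ∘ suc
  g′ = g ∘ suc
  toℕ-∨-∧ : ∀ a b → toℕ (a ∨ b) + toℕ (a ∧ b) ≡ toℕ a + toℕ b
  toℕ-∨-∧ false b     = ℕ.+-identityʳ (toℕ b)
  toℕ-∨-∧ true  false = refl
  toℕ-∨-∧ true  true  = refl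

countB-∪ : ∀ {m} (f g : A m) → countB (f ∪ g) ≤ countB f + countB g
countB-∪ f g = ℕ.≤-trans (ℕ.m≤m+n _ _) (ℕ.≤-reflexive (countB-∪-∩ f g))

countB-∪-disjoint : ∀ {m} (f g : A m) → NoCommonSummand f g → countB f + countB g ≡ countB (f ∪ g)
countB-∪-disjoint f g disjoint = begin
  countB f + countB g              ≡⟨ countB-∪-∩ f g ⟨
  countB (f ∪ g) + countB (f ∩ g)  ≡⟨ cong (countB (f ∪ g) +_) (countB-false (f ∩ g) f∩g≡false) ⟩
  countB (f ∪ g) + 0               ≡⟨ ℕ.+-identityʳ _ ⟩
  countB (f ∪ g)                   ∎
  where
  open ≡-Reasoning
  f∩g≡false : ∀ e → f e ∧ g e ≡ false
  f∩g≡false e with f e in fe | g e in ge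
  ... | false | _     = refl
  ... | true  | false = refl
  ... | true  | true  = ⊥-elim (disjoint e (fe , ge))

countB-edge : ∀ {m} (a : Fin m) (h : A m) → countB (edge a ∩ h) ≡ toℕ (h a)
countB-edge {suc m} zero h = begin
  countB (edge zero ∩ h)                  ≡⟨ countB-suc (edge zero ∩ h) ⟩
  toℕ (h zero) + countB {m} (λ _ → false) ≡⟨ cong (toℕ (h zero) +_) (countB-false {m} _ (λ _ → refl)) ⟩
  toℕ (h zero) + 0                        ≡⟨ ℕ.+-identityʳ _ ⟩
  toℕ (h zero)                            ∎
  where open ≡-Reasoning
countB-edge (suc a) h = trans (countB-suc (edge (suc a) ∩ h)) (countB-edge a (h ∘ suc))

xorSum-cong : ∀ {m} {f g : A m} → (∀ e → f e ≡ g e) → xorSum f ≡ xorSum g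
xorSum-cong {zero}  f≗g = refl
xorSum-cong {suc m} f≗g = cong₂ _xor_ (f≗g zero) (xorSum-cong (f≗g ∘ suc))

xorSum-⊕ : ∀ {m} (f g : A m) → xorSum (f ⊕ g) ≡ xorSum f xor xorSum g
xorSum-⊕ {zero}  f g = refl
xorSum-⊕ {suc m} f g = begin
  (f zero xor g zero) xor xorSum ((f ⊕ g) ∘ suc)
    ≡⟨ cong ((f zero xor g zero) xor_) (xorSum-⊕ (f ∘ suc) (g ∘ suc)) ⟩
  (f zero xor g zero) xor (xorSum (f ∘ suc) xor xorSum (g ∘ suc))
    ≡⟨ xor-Semigroup.interchange (f zero) (g zero) _ _ ⟩
  (f zero xor xorSum (f ∘ suc)) xor (g zero xor xorSum (g ∘ suc)) ∎
  where open ≡-Reasoning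

xorSum-edge : ∀ {m} (a : Fin m) (h : A m) → xorSum (edge a ∩ h) ≡ h a
xorSum-edge {suc m} zero    h = trans (cong (h zero xor_) (xorSum-false m)) (xor-identityʳ (h zero))
  where
  xorSum-false : ∀ m → xorSum {m} (λ _ → false) ≡ false
  xorSum-false zero    = refl
  xorSum-false (suc m) = xorSum-false m
xorSum-edge {suc m} (suc a) h = xorSum-edge a (h ∘ suc)

-- incident G e is, by definition, pair applied to the two ends of e.
pair : ∀ {n} → Fin n → Fin n → A n
pair a b v = does (v ≟ a) ∨ does (v ≟ b)

pair-left : ∀ {n} (a b : Fin n) → pair a b a ≡ true
pair-left a b rewrite dec-true (a ≟ a) refl = refl

pair-right : ∀ {n} (a b : Fin n) → pair a b b ≡ true
pair-right a b rewrite dec-true (b ≟ b) refl = ∨-zeroʳ (does (b ≟ a))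

pair-true : ∀ {n} (a b v : Fin n) → pair a b v ≡ true → v ≡ a ⊎ v ≡ b
pair-true a b v abv with v ≟ a | v ≟ b
... | yes v≡a | _       = inj₁ v≡a
... | no  _   | yes v≡b = inj₂ v≡b

pair-unique : ∀ {n} {x y a b : Fin n} → a ≢ b → pair x y a ≡ true → pair x y b ≡ true →
              ∀ v → pair x y v ≡ pair a b v
pair-unique {x = x} {y} {a} {b} a≢b xya xyb v with pair-true x y a xya | pair-true x y b xyb
... | inj₁ refl | inj₂ refl = refl
... | inj₂ refl | inj₁ refl = ∨-comm (does (v ≟ x)) (does (v ≟ y))
... | inj₁ refl | inj₁ refl = ⊥-elim (a≢b refl)
... | inj₂ refl | inj₂ refl = ⊥-elim (a≢b refl)

module _ {n} (σ : Permutation′ n) where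

  permute-injective : ∀ {i j} → σ ⟨$⟩ʳ i ≡ σ ⟨$⟩ʳ j → i ≡ j
  permute-injective σi≡σj = trans (sym (inverseˡ σ)) (trans (cong (σ ⟨$⟩ˡ_) σi≡σj) (inverseˡ σ))

  permute-surjective : ∀ v → ∃ λ i → v ≡ σ ⟨$⟩ʳ i
  permute-surjective v = σ ⟨$⟩ˡ v , sym (inverseʳ σ)

  permute-all : ∀ {P : Fin n → Set} → (∀ i → P (σ ⟨$⟩ʳ i)) → ∀ v → P v
  permute-all P∘σ v with permute-surjective v
  ... | i , refl = P∘σ i

  pair-permute : ∀ a b i → pair (σ ⟨$⟩ʳ a) (σ ⟨$⟩ʳ b) (σ ⟨$⟩ʳ i) ≡ pair a b i
  pair-permute a b i = cong₂ _∨_ (does-permute a) (does-permute b)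
    where
    does-permute : ∀ j → does (σ ⟨$⟩ʳ i ≟ σ ⟨$⟩ʳ j) ≡ does (i ≟ j)
    does-permute j = does-⇔ (mk⇔ permute-injective (cong (σ ⟨$⟩ʳ_))) (σ ⟨$⟩ʳ i ≟ σ ⟨$⟩ʳ j) (i ≟ j)

module _ {n m} (G : Graph n m) where

  edgesAt : Fin n → A m
  edgesAt v e = incident G e v

  degreeIn : A m → Fin n → ℕ
  degreeIn S v = countB (S ∩ edgesAt v)

  IsVJoin : A m → Set
  IsVJoin J = ∀ v → boundary G J v ≡ allVertices v

  boundary-edge : ∀ a v → boundary G (edge a) v ≡ incident G a v
  boundary-edge a v = xorSum-edge a (edgesAt v)

  boundary-edge-⊕ : ∀ a p v → boundary G (edge a ⊕ p) v ≡ incident G a v xor boundary G p v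
  boundary-edge-⊕ a p v = begin
    xorSum ((edge a ⊕ p) ∩ edgesAt v)
      ≡⟨ xorSum-cong (λ e → ∧-distribʳ-xor (incident G e v) (edge a e) (p e)) ⟩
    xorSum ((edge a ∩ edgesAt v) ⊕ (p ∩ edgesAt v))
      ≡⟨ xorSum-⊕ (edge a ∩ edgesAt v) (p ∩ edgesAt v) ⟩
    boundary G (edge a) v xor boundary G p v
      ≡⟨ cong (_xor boundary G p v) (boundary-edge a v) ⟩
    incident G a v xor boundary G p v ∎
    where open ≡-Reasoning

  degreeIn-edge : ∀ a v → degreeIn (edge a) v ≡ toℕ (incident G a v)
  degreeIn-edge a v = countB-edge a (edgesAt v)

  degreeIn-edge-⊕ : ∀ a p v → degreeIn (edge a ⊕ p) v ≤ toℕ (incident G a v) + degreeIn p v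
  degreeIn-edge-⊕ a p v = begin
    countB ((edge a ⊕ p) ∩ edgesAt v)                ≤⟨ countB-mono ⊕∩⊆∪ ⟩
    countB ((edge a ∩ edgesAt v) ∪ (p ∩ edgesAt v))  ≤⟨ countB-∪ (edge a ∩ edgesAt v) (p ∩ edgesAt v) ⟩
    degreeIn (edge a) v + degreeIn p v               ≡⟨ cong (_+ degreeIn p v) (degreeIn-edge a v) ⟩
    toℕ (incident G a v) + degreeIn p v              ∎
    where
    open ℕ.≤-Reasoning
    ⊕∩⊆∪ : ((edge a ⊕ p) ∩ edgesAt v) ⊆ ((edge a ∩ edgesAt v) ∪ (p ∩ edgesAt v))
    ⊕∩⊆∪ e = ⊕-⊆-∪ (edge a ∩ edgesAt v) (p ∩ edgesAt v) e
           ∘ trans (sym (∧-distribʳ-xor (incident G e v) (edge a e) (p e)))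

  degreeIn-∖ : ∀ S J v → degreeIn S v ≤ degreeIn J v + degreeIn (S ∖ J) v
  degreeIn-∖ S J v = ℕ.≤-trans (countB-mono split) (countB-∪ (J ∩ edgesAt v) ((S ∖ J) ∩ edgesAt v))
    where
    split : (S ∩ edgesAt v) ⊆ ((J ∩ edgesAt v) ∪ ((S ∖ J) ∩ edgesAt v))
    split e with S e | J e | incident G e v
    ... | true  | true  | true  = λ _ → refl
    ... | true  | false | true  = λ _ → refl
    ... | true  | _     | false = λ ()
    ... | false | _     | _     = λ ()

  degreeIn-remove : ∀ {r k} S J v → r + k ≤ degreeIn S v → degreeIn J v ≤ r → k ≤ degreeIn (S ∖ J) v
  degreeIn-remove {r} {k} S J v r+k≤S J≤r = ℕ.+-cancelˡ-≤ r k (degreeIn (S ∖ J) v) (begin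
    r + k                                ≤⟨ r+k≤S ⟩
    degreeIn S v                         ≤⟨ degreeIn-∖ S J v ⟩
    degreeIn J v + degreeIn (S ∖ J) v    ≤⟨ ℕ.+-monoˡ-≤ (degreeIn (S ∖ J) v) J≤r ⟩
    r + degreeIn (S ∖ J) v               ∎)
    where open ℕ.≤-Reasoning

  incident-permute : ∀ σ {i j e} → i ≢ j →
                     incident G e (σ ⟨$⟩ʳ i) ≡ true → incident G e (σ ⟨$⟩ʳ j) ≡ true →
                     ∀ l → incident G e (σ ⟨$⟩ʳ l) ≡ pair i j l
  incident-permute σ {i} {j} {e} i≢j ei ej l =
    trans (pair-unique {x = proj₁ (ends G e)} {proj₂ (ends G e)} (i≢j ∘ permute-injective σ) ei ej (σ ⟨$⟩ʳ l))
          (pair-permute σ i j l)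

  other-end : ∀ e v → incident G e v ≡ true → ∃ λ u → u ≢ v × incident G e u ≡ true
  other-end e v ev with ends G e | noLoops G e
  ... | x , y | x≢y with pair-true x y v ev
  ...   | inj₁ refl = y , x≢y ∘ sym , pair-right x y
  ...   | inj₂ refl = x , x≢y , pair-left x y

  record Joined (S : A m) (a b : Fin n) : Set where
    constructor joined-by
    field
      through   : Fin m
      through∈S : S through ≡ true
      meets-a   : incident G through a ≡ true
      meets-b   : incident G through b ≡ true

  joined? : ∀ S a b → Dec (Joined S a b)
  joined? S a b =
    map′ (λ (e , Se , ea , eb) → joined-by e Se ea eb) (λ (joined-by e Se ea eb) → e , Se , ea , eb)
         (any? (λ e → (S e ≟ᵇ true) ×-dec (incident G e a ≟ᵇ true) ×-dec (incident G e b ≟ᵇ true)))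

  Joined-sym : ∀ {S a b} → Joined S a b → Joined S b a
  Joined-sym (joined-by e Se ea eb) = joined-by e Se eb ea

  ¬Joined-sym : ∀ {S a b} → ¬ Joined S a b → ¬ Joined S b a
  ¬Joined-sym ¬ab = ¬ab ∘ Joined-sym

  ¬Joined⇒disjoint : ∀ {S a b} → ¬ Joined S a b → NoCommonSummand (S ∩ edgesAt a) (S ∩ edgesAt b)
  ¬Joined⇒disjoint {S} {a} {b} ¬ab e (Sea , Seb) =
    ¬ab (joined-by e (∧-conicalˡ (S e) _ Sea) (∧-conicalʳ (S e) _ Sea) (∧-conicalʳ (S e) _ Seb))

  positive-degree⇒edge : ∀ S v → 0 < degreeIn S v → ∃ λ e → S e ≡ true × incident G e v ≡ true
  positive-degree⇒edge S v 0<deg with countB-positive (S ∩ edgesAt v) 0<deg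
  ... | e , Sev = e , ∧-conicalˡ (S e) (incident G e v) Sev , ∧-conicalʳ (S e) (incident G e v) Sev

  positive-degree⇒joined : ∀ S v → 0 < degreeIn S v → ∃ λ u → u ≢ v × Joined S v u
  positive-degree⇒joined S v 0<deg with positive-degree⇒edge S v 0<deg
  ... | e , Se , ev with other-end e v ev
  ... | u , u≢v , eu = u , u≢v , joined-by e Se ev eu

-- Every join below is the image, under a permutation σ of the vertices, of one of these two
-- standard configurations: the perfect matching {01, 23} and the star with centre 0.

fin4-cases : ∀ {P : Fin 4 → Set} → P (# 0) → P (# 1) → P (# 2) → P (# 3) → ∀ i → P i
fin4-cases p₀ p₁ p₂ p₃ zero                   = p₀
fin4-cases p₀ p₁ p₂ p₃ (suc zero)             = p₁
fin4-cases p₀ p₁ p₂ p₃ (suc (suc zero))       = p₂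
fin4-cases p₀ p₁ p₂ p₃ (suc (suc (suc zero))) = p₃

matching-parity : ∀ i → pair (# 0) (# 1) i xor pair (# 2) (# 3) i ≡ true
matching-parity = fin4-cases refl refl refl refl

matching-multiplicity : ∀ i → toℕ (pair (# 0) (# 1) i) + toℕ (pair (# 2) (# 3) i) ≡ 1
matching-multiplicity = fin4-cases refl refl refl refl

star-parity : ∀ i → pair (# 0) (# 1) i xor (pair (# 0) (# 2) i xor pair (# 0) (# 3) i) ≡ true
star-parity = fin4-cases refl refl refl refl

star-leaf-multiplicity : ∀ (i : Fin 3) →
  toℕ (pair (# 0) (# 1) (suc i)) + (toℕ (pair (# 0) (# 2) (suc i)) + toℕ (pair (# 0) (# 3) (suc i))) ≡ 1
star-leaf-multiplicity zero             = refl
star-leaf-multiplicity (suc zero)       = refl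
star-leaf-multiplicity (suc (suc zero)) = refl

module _ {m} (G : Graph 4 m) where

  RemovableVJoin : A m → ℕ → Set
  RemovableVJoin S k = Σ (A m) λ J → J ⊆ S × IsVJoin G J × (∀ v → k ≤ degreeIn G (S ∖ J) v)

  matching⇒RemovableVJoin : ∀ σ {k S} → (∀ v → suc k ≤ degreeIn G S v) →
                            Joined G S (σ ⟨$⟩ʳ # 0) (σ ⟨$⟩ʳ # 1) → Joined G S (σ ⟨$⟩ʳ # 2) (σ ⟨$⟩ʳ # 3) →
                            RemovableVJoin S k
  matching⇒RemovableVJoin σ {k} {S} deg (joined-by e₁ Se₁ e₁0 e₁1) (joined-by e₂ Se₂ e₂2 e₂3) =
    J , ⊕-⊆ (edge-⊆ Se₁) (edge-⊆ Se₂) , permute-all σ J-parity , permute-all σ remaining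
    where
    J : A m
    J = edge e₁ ⊕ edge e₂
    vertex : Fin 4 → Fin 4
    vertex i = σ ⟨$⟩ʳ i
    e₁-at : ∀ i → incident G e₁ (vertex i) ≡ pair (# 0) (# 1) i
    e₁-at = incident-permute G σ (λ ()) e₁0 e₁1
    e₂-at : ∀ i → incident G e₂ (vertex i) ≡ pair (# 2) (# 3) i
    e₂-at = incident-permute G σ (λ ()) e₂2 e₂3
    J-parity : ∀ i → boundary G J (vertex i) ≡ true
    J-parity i = begin
      boundary G J (vertex i)
        ≡⟨ boundary-edge-⊕ G e₁ (edge e₂) (vertex i) ⟩
      incident G e₁ (vertex i) xor boundary G (edge e₂) (vertex i)
        ≡⟨ cong₂ _xor_ (e₁-at i) (trans (boundary-edge G e₂ (vertex i)) (e₂-at i)) ⟩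
      pair (# 0) (# 1) i xor pair (# 2) (# 3) i
        ≡⟨ matching-parity i ⟩
      true ∎
      where open ≡-Reasoning
    J-degree : ∀ i → degreeIn G J (vertex i) ≤ 1
    J-degree i = begin
      degreeIn G J (vertex i)
        ≤⟨ degreeIn-edge-⊕ G e₁ (edge e₂) (vertex i) ⟩
      toℕ (incident G e₁ (vertex i)) + degreeIn G (edge e₂) (vertex i)
        ≡⟨ cong₂ _+_ (cong toℕ (e₁-at i)) (trans (degreeIn-edge G e₂ (vertex i)) (cong toℕ (e₂-at i))) ⟩
      toℕ (pair (# 0) (# 1) i) + toℕ (pair (# 2) (# 3) i)
        ≡⟨ matching-multiplicity i ⟩
      1 ∎
      where open ℕ.≤-Reasoning
    remaining : ∀ i → k ≤ degreeIn G (S ∖ J) (vertex i)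
    remaining i = degreeIn-remove G S J (vertex i) (deg (vertex i)) (J-degree i)

  star⇒RemovableVJoin : ∀ σ {k S} → (∀ v → suc k ≤ degreeIn G S v) → 3 + k ≤ degreeIn G S (σ ⟨$⟩ʳ # 0) →
                        Joined G S (σ ⟨$⟩ʳ # 0) (σ ⟨$⟩ʳ # 1) → Joined G S (σ ⟨$⟩ʳ # 0) (σ ⟨$⟩ʳ # 2) →
                        Joined G S (σ ⟨$⟩ʳ # 0) (σ ⟨$⟩ʳ # 3) → RemovableVJoin S k
  star⇒RemovableVJoin σ {k} {S} deg centre-deg
                      (joined-by e₁ Se₁ e₁0 e₁1) (joined-by e₂ Se₂ e₂0 e₂2) (joined-by e₃ Se₃ e₃0 e₃3) =
    J , ⊕-⊆ (edge-⊆ Se₁) (⊕-⊆ (edge-⊆ Se₂) (edge-⊆ Se₃)) , permute-all σ J-parity , permute-all σ remaining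
    where
    J : A m
    J = edge e₁ ⊕ (edge e₂ ⊕ edge e₃)
    vertex : Fin 4 → Fin 4
    vertex i = σ ⟨$⟩ʳ i
    e₁-at : ∀ i → incident G e₁ (vertex i) ≡ pair (# 0) (# 1) i
    e₁-at = incident-permute G σ (λ ()) e₁0 e₁1
    e₂-at : ∀ i → incident G e₂ (vertex i) ≡ pair (# 0) (# 2) i
    e₂-at = incident-permute G σ (λ ()) e₂0 e₂2
    e₃-at : ∀ i → incident G e₃ (vertex i) ≡ pair (# 0) (# 3) i
    e₃-at = incident-permute G σ (λ ()) e₃0 e₃3
    J-parity : ∀ i → boundary G J (vertex i) ≡ true
    J-parity i = begin
      boundary G J (vertex i)
        ≡⟨ boundary-edge-⊕ G e₁ (edge e₂ ⊕ edge e₃) (vertex i) ⟩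
      incident G e₁ (vertex i) xor boundary G (edge e₂ ⊕ edge e₃) (vertex i)
        ≡⟨ cong (incident G e₁ (vertex i) xor_) (boundary-edge-⊕ G e₂ (edge e₃) (vertex i)) ⟩
      incident G e₁ (vertex i) xor (incident G e₂ (vertex i) xor boundary G (edge e₃) (vertex i))
        ≡⟨ cong₂ _xor_ (e₁-at i) (cong₂ _xor_ (e₂-at i) (trans (boundary-edge G e₃ (vertex i)) (e₃-at i))) ⟩
      pair (# 0) (# 1) i xor (pair (# 0) (# 2) i xor pair (# 0) (# 3) i)
        ≡⟨ star-parity i ⟩
      true ∎
      where open ≡-Reasoning
    J-degree : ∀ i → degreeIn G J (vertex i) ≤
                     toℕ (pair (# 0) (# 1) i) + (toℕ (pair (# 0) (# 2) i) + toℕ (pair (# 0) (# 3) i))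
    J-degree i = begin
      degreeIn G J (vertex i)
        ≤⟨ degreeIn-edge-⊕ G e₁ (edge e₂ ⊕ edge e₃) (vertex i) ⟩
      toℕ (incident G e₁ (vertex i)) + degreeIn G (edge e₂ ⊕ edge e₃) (vertex i)
        ≤⟨ ℕ.+-monoʳ-≤ (toℕ (incident G e₁ (vertex i))) (degreeIn-edge-⊕ G e₂ (edge e₃) (vertex i)) ⟩
      toℕ (incident G e₁ (vertex i)) + (toℕ (incident G e₂ (vertex i)) + degreeIn G (edge e₃) (vertex i))
        ≡⟨ cong₂ _+_ (cong toℕ (e₁-at i))
                     (cong₂ _+_ (cong toℕ (e₂-at i)) (trans (degreeIn-edge G e₃ (vertex i)) (cong toℕ (e₃-at i)))) ⟩
      toℕ (pair (# 0) (# 1) i) + (toℕ (pair (# 0) (# 2) i) + toℕ (pair (# 0) (# 3) i)) ∎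
      where open ℕ.≤-Reasoning
    remaining : ∀ i → k ≤ degreeIn G (S ∖ J) (vertex i)
    remaining zero    = degreeIn-remove G S J (vertex zero) centre-deg (J-degree zero)
    remaining (suc i) = degreeIn-remove G S J (vertex (suc i)) (deg (vertex (suc i)))
                          (ℕ.≤-trans (J-degree (suc i)) (ℕ.≤-reflexive (star-leaf-multiplicity i)))

  LeavesApart : Permutation′ 4 → A m → Set
  LeavesApart σ S = ∀ (i j : Fin 3) → i ≢ j → ¬ Joined G S (σ ⟨$⟩ʳ suc i) (σ ⟨$⟩ʳ suc j)

  leaves-apart : ∀ σ {S} → ¬ Joined G S (σ ⟨$⟩ʳ # 1) (σ ⟨$⟩ʳ # 2) → ¬ Joined G S (σ ⟨$⟩ʳ # 1) (σ ⟨$⟩ʳ # 3) →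
                                 ¬ Joined G S (σ ⟨$⟩ʳ # 2) (σ ⟨$⟩ʳ # 3) → LeavesApart σ S
  leaves-apart σ ¬12 ¬13 ¬23 = λ where
    zero             (suc zero)       _ → ¬12
    zero             (suc (suc zero)) _ → ¬13
    (suc zero)       (suc (suc zero)) _ → ¬23
    (suc zero)       zero             _ → ¬Joined-sym G ¬12
    (suc (suc zero)) zero             _ → ¬Joined-sym G ¬13
    (suc (suc zero)) (suc zero)       _ → ¬Joined-sym G ¬23
    zero             zero             i≢i → ⊥-elim (i≢i refl)
    (suc zero)       (suc zero)       i≢i → ⊥-elim (i≢i refl)
    (suc (suc zero)) (suc (suc zero)) i≢i → ⊥-elim (i≢i refl)

  leaf-edges-meet-centre : ∀ σ {S} → LeavesApart σ S → ∀ i e → S e ≡ true →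
                           incident G e (σ ⟨$⟩ʳ suc i) ≡ true → incident G e (σ ⟨$⟩ʳ # 0) ≡ true
  leaf-edges-meet-centre σ apart i e Se ei with other-end G e (σ ⟨$⟩ʳ suc i) ei
  ... | u , u≢leaf , eu with permute-surjective σ u
  ... | zero  , refl = eu
  ... | suc j , refl = ⊥-elim (apart i j (λ { refl → u≢leaf refl }) (joined-by e Se ei eu))

  apart-leaves⇒RemovableVJoin : ∀ σ {k S} → (∀ v → suc k ≤ degreeIn G S v) → LeavesApart σ S →
                                RemovableVJoin S k
  apart-leaves⇒RemovableVJoin σ {k} {S} deg apart =
    star⇒RemovableVJoin σ deg centre-degree (spoke (# 0)) (spoke (# 1)) (spoke (# 2))
    where
    meets-centre : ∀ i e → S e ≡ true → incident G e (σ ⟨$⟩ʳ suc i) ≡ true → incident G e (σ ⟨$⟩ʳ # 0) ≡ true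
    meets-centre = leaf-edges-meet-centre σ apart
    spoke : ∀ i → Joined G S (σ ⟨$⟩ʳ # 0) (σ ⟨$⟩ʳ suc i)
    spoke i with positive-degree⇒edge G S (σ ⟨$⟩ʳ suc i) (ℕ.≤-trans (s≤s z≤n) (deg (σ ⟨$⟩ʳ suc i)))
    ... | e , Se , ei = joined-by e Se (meets-centre i e Se ei) ei
    at : Fin 4 → A m
    at i = S ∩ edgesAt G (σ ⟨$⟩ʳ i)
    leaves-disjoint : ∀ i j → i ≢ j → NoCommonSummand (at (suc i)) (at (suc j))
    leaves-disjoint i j i≢j = ¬Joined⇒disjoint G (apart i j i≢j)
    leaf⊆centre : ∀ i → at (suc i) ⊆ at (# 0)
    leaf⊆centre i = ∩-monoʳ {S = S} (meets-centre i)
    centre-degree : 3 + k ≤ degreeIn G S (σ ⟨$⟩ʳ # 0)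
    centre-degree = begin
      3 + k
        ≤⟨ ℕ.+-mono-≤ (s≤s z≤n) (ℕ.+-mono-≤ (s≤s z≤n) ℕ.≤-refl) ⟩
      suc k + (suc k + suc k)
        ≤⟨ ℕ.+-mono-≤ (deg (σ ⟨$⟩ʳ # 1)) (ℕ.+-mono-≤ (deg (σ ⟨$⟩ʳ # 2)) (deg (σ ⟨$⟩ʳ # 3))) ⟩
      countB (at (# 1)) + (countB (at (# 2)) + countB (at (# 3)))
        ≡⟨ cong (countB (at (# 1)) +_)
                (countB-∪-disjoint (at (# 2)) (at (# 3)) (leaves-disjoint (# 1) (# 2) (λ ()))) ⟩
      countB (at (# 1)) + countB (at (# 2) ∪ at (# 3))
        ≡⟨ countB-∪-disjoint (at (# 1)) (at (# 2) ∪ at (# 3))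
             (disjoint-∪ (leaves-disjoint (# 0) (# 1) (λ ())) (leaves-disjoint (# 0) (# 2) (λ ()))) ⟩
      countB (at (# 1) ∪ (at (# 2) ∪ at (# 3)))
        ≤⟨ countB-mono (∪-⊆ (leaf⊆centre (# 0)) (∪-⊆ (leaf⊆centre (# 1)) (leaf⊆centre (# 2)))) ⟩
      countB (at (# 0)) ∎
      where open ℕ.≤-Reasoning

  isolated-absurd : ∀ σ {k S} → (∀ v → suc k ≤ degreeIn G S v) →
                    ¬ Joined G S (σ ⟨$⟩ʳ # 0) (σ ⟨$⟩ʳ # 1) → ¬ Joined G S (σ ⟨$⟩ʳ # 0) (σ ⟨$⟩ʳ # 2) →
                    ¬ Joined G S (σ ⟨$⟩ʳ # 0) (σ ⟨$⟩ʳ # 3) → ⊥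
  isolated-absurd σ {S = S} deg ¬01 ¬02 ¬03
    with positive-degree⇒joined G S (σ ⟨$⟩ʳ # 0) (ℕ.≤-trans (s≤s z≤n) (deg (σ ⟨$⟩ʳ # 0)))
  ... | u , u≢centre , joined with permute-surjective σ u
  ... | zero                 , refl = u≢centre refl
  ... | suc zero             , refl = ¬01 joined
  ... | suc (suc zero)       , refl = ¬02 joined
  ... | suc (suc (suc zero)) , refl = ¬03 joined

  -- Choosing a missing pair from each of the three perfect matchings either picks the three pairs
  -- through one vertex, which is then isolated, or a triangle, whose complement is a star.
  no-perfect-matching⇒RemovableVJoin : ∀ {k} S → (∀ v → suc k ≤ degreeIn G S v) →
    ¬ Joined G S (# 0) (# 1) ⊎ ¬ Joined G S (# 2) (# 3) →
    ¬ Joined G S (# 0) (# 2) ⊎ ¬ Joined G S (# 1) (# 3) →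
    ¬ Joined G S (# 0) (# 3) ⊎ ¬ Joined G S (# 1) (# 2) → RemovableVJoin S k
  no-perfect-matching⇒RemovableVJoin S deg (inj₁ ¬01) (inj₁ ¬02) (inj₁ ¬03) =
    ⊥-elim (isolated-absurd id deg ¬01 ¬02 ¬03)
  no-perfect-matching⇒RemovableVJoin S deg (inj₁ ¬01) (inj₂ ¬13) (inj₂ ¬12) =
    ⊥-elim (isolated-absurd (transpose (# 0) (# 1)) deg (¬Joined-sym G ¬01) ¬12 ¬13)
  no-perfect-matching⇒RemovableVJoin S deg (inj₂ ¬23) (inj₁ ¬02) (inj₂ ¬12) =
    ⊥-elim (isolated-absurd (transpose (# 0) (# 2)) deg (¬Joined-sym G ¬12) (¬Joined-sym G ¬02) ¬23)
  no-perfect-matching⇒RemovableVJoin S deg (inj₂ ¬23) (inj₂ ¬13) (inj₁ ¬03) =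
    ⊥-elim (isolated-absurd (transpose (# 0) (# 3)) deg (¬Joined-sym G ¬13) (¬Joined-sym G ¬23) (¬Joined-sym G ¬03))
  no-perfect-matching⇒RemovableVJoin S deg (inj₂ ¬23) (inj₂ ¬13) (inj₂ ¬12) =
    apart-leaves⇒RemovableVJoin id deg (leaves-apart id ¬12 ¬13 ¬23)
  no-perfect-matching⇒RemovableVJoin S deg (inj₂ ¬23) (inj₁ ¬02) (inj₁ ¬03) =
    apart-leaves⇒RemovableVJoin (transpose (# 0) (# 1)) deg (leaves-apart (transpose (# 0) (# 1)) ¬02 ¬03 ¬23)
  no-perfect-matching⇒RemovableVJoin S deg (inj₁ ¬01) (inj₂ ¬13) (inj₁ ¬03) =
    apart-leaves⇒RemovableVJoin (transpose (# 0) (# 2)) deg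
      (leaves-apart (transpose (# 0) (# 2)) (¬Joined-sym G ¬01) ¬13 ¬03)
  no-perfect-matching⇒RemovableVJoin S deg (inj₁ ¬01) (inj₁ ¬02) (inj₂ ¬12) =
    apart-leaves⇒RemovableVJoin (transpose (# 0) (# 3)) deg
      (leaves-apart (transpose (# 0) (# 3)) ¬12 (¬Joined-sym G ¬01) (¬Joined-sym G ¬02))

  matching-or-gap : ∀ S a b c d → (Joined G S a b × Joined G S c d) ⊎ (¬ Joined G S a b ⊎ ¬ Joined G S c d)
  matching-or-gap S a b c d with joined? G S a b | joined? G S c d
  ... | yes ab | yes cd = inj₁ (ab , cd)
  ... | no ¬ab | _      = inj₂ (inj₁ ¬ab)
  ... | yes _  | no ¬cd = inj₂ (inj₂ ¬cd)

  removable-vjoin : ∀ {k} S → (∀ v → suc k ≤ degreeIn G S v) → RemovableVJoin S k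
  removable-vjoin S deg with matching-or-gap S (# 0) (# 1) (# 2) (# 3)
                           | matching-or-gap S (# 0) (# 2) (# 1) (# 3)
                           | matching-or-gap S (# 0) (# 3) (# 1) (# 2)
  ... | inj₁ (ab , cd) | _              | _              = matching⇒RemovableVJoin id deg ab cd
  ... | inj₂ _         | inj₁ (ab , cd) | _              = matching⇒RemovableVJoin (transpose (# 1) (# 2)) deg ab cd
  ... | inj₂ _         | inj₂ _         | inj₁ (ab , cd) =
    matching⇒RemovableVJoin (transpose (# 1) (# 3)) deg ab (Joined-sym G cd)
  ... | inj₂ gap₁      | inj₂ gap₂      | inj₂ gap₃      = no-perfect-matching⇒RemovableVJoin S deg gap₁ gap₂ gap₃

  disjoint-vjoins : ∀ k S → (∀ v → k ≤ degreeIn G S v) →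
                    Σ (Fin k → A m) λ p → (∀ i j → i ≢ j → NoCommonSummand (p i) (p j)) ×
                                          (∀ i → p i ⊆ S) × (∀ i → IsVJoin G (p i))
  disjoint-vjoins zero    S _   = (λ ()) , (λ ()) , (λ ()) , (λ ())
  disjoint-vjoins (suc k) S deg with removable-vjoin S deg
  ... | J , J⊆S , J-vjoin , deg′ with disjoint-vjoins k (S ∖ J) deg′
  ... | p , p-disjoint , p⊆S∖J , p-vjoin = J ∷ p , disjoint , ⊆S , vjoin
    where
    J-disjoint : ∀ i → NoCommonSummand J (p i)
    J-disjoint i e (Je , pie) with J e | ∧-conicalʳ (S e) _ (p⊆S∖J i e pie)
    ... | true | ()
    disjoint : ∀ i j → i ≢ j → NoCommonSummand ((J ∷ p) i) ((J ∷ p) j)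
    disjoint zero    zero    0≢0 = ⊥-elim (0≢0 refl)
    disjoint zero    (suc j) _   = J-disjoint j
    disjoint (suc i) zero    _   = λ e (pie , Je) → J-disjoint i e (Je , pie)
    disjoint (suc i) (suc j) i≢j = p-disjoint i j (i≢j ∘ cong suc)
    ⊆S : ∀ i → (J ∷ p) i ⊆ S
    ⊆S zero    = J⊆S
    ⊆S (suc i) e pie = ∧-conicalˡ (S e) _ (p⊆S∖J i e pie)
    vjoin : ∀ i → IsVJoin G ((J ∷ p) i)
    vjoin zero    = J-vjoin
    vjoin (suc i) = p-vjoin i

lemma2p2 : (k m : ℕ) → 0 < k → (G : Graph 4 m) → (∀ v → k ≤ degree G v) →
    Σ (Fin k → A m) λ p →
      (∀ i j → i ≢ j → NoCommonSummand (p i) (p j)) × (∀ i v → boundary G (p i) v ≡ allVertices v)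
lemma2p2 k m _ G deg with disjoint-vjoins G k (λ _ → true) deg
... | p , disjoint , _ , vjoin = p , disjoint , vjoin
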